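{- If $A$ is a primitive subset of a finite vector space $V$ over $\mathbb{F}_3$, then $0\notin A+A+A+A$.
   Context: For an affine subspace $U$ of $V$, $[U]=U-U$, $\dim U=\dim[U]$; for affine subspaces $U\subseteq H$, $\dim(H/U)=\dim H-\dim U$; $C(U)$ is the linear span of $U$; a hyperplane is an affine subspace of codimension $1$; $\mathrm{aff}$ is the affine hull. For affine subspaces $U\subseteq H$, $W\subseteq H$ is an $(H,U)$-half if $W+[U]=W$ and $H$ is the disjoint union of $U$, $W$ and $(-U)+(-W)$. Primitive sets (recursively on $\dim V$): $A\subseteq V$ is primitive if either (a) $A$ is a hyperplane not containing $0$, or (b) there exist a hyperplane $H$ with $0\notin H$, a proper affine subspace $U\subsetneq H$, an $(H,U)$-half $W$, and a primitive subset $X$ of $C(U)$ with (i) $A=W\cup X$, (ii) $X\cap[U]=\emptyset$, (iii) $\dim(H/U)\ge2$ or $X\ne -U$, (iv) $\mathrm{aff}(X\cap(-U))=-U$. -}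

module Defs where

open import Data.Nat using (ℕ; zero; suc; _+_; _≤_)
open import Data.Fin using (Fin)
import Data.Fin as Fin
open import Data.Vec using (Vec; zipWith; map; replicate)
open import Data.Product using (Σ; ∃; ∃-syntax; _×_; _,_)
open import Data.Sum using (_⊎_)
open import Data.Empty using (⊥)
open import Data.Unit using (⊤)
open import Relation.Nullary using (¬_)
open import Relation.Binary.PropositionalEquality using (_≡_)
open import Function using (_∘_)

data F3 : Set where
  f0 f1 f2 : F3

_+₃_ : F3 → F3 → F3
f0 +₃ y  = y
f1 +₃ f0 = f1
f1 +₃ f1 = f2
f1 +₃ f2 = f0
f2 +₃ f0 = f2
f2 +₃ f1 = f0
f2 +₃ f2 = f1

_*₃_ : F3 → F3 → F3
f0 *₃ y  = f0
f1 *₃ y  = y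
f2 *₃ f0 = f0
f2 *₃ f1 = f2
f2 *₃ f2 = f1

-₃_ : F3 → F3
-₃ f0 = f0
-₃ f1 = f2
-₃ f2 = f1

V : ℕ → Set
V n = Vec F3 n

_+ᵥ_ : ∀ {n} → V n → V n → V n
_+ᵥ_ = zipWith _+₃_

_·ᵥ_ : ∀ {n} → F3 → V n → V n
c ·ᵥ v = map (c *₃_) v

-ᵥ_ : ∀ {n} → V n → V n
-ᵥ_ = map -₃_

0ᵥ : ∀ {n} → V n
0ᵥ = replicate _ f0

lincomb : ∀ {n} k → (Fin k → F3) → (Fin k → V n) → V n
lincomb zero    c v = 0ᵥ
lincomb (suc k) c v = (c Fin.zero ·ᵥ v Fin.zero) +ᵥ lincomb k (c ∘ Fin.suc) (v ∘ Fin.suc)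

sum₃ : ∀ k → (Fin k → F3) → F3
sum₃ zero    c = f0
sum₃ (suc k) c = c Fin.zero +₃ sum₃ k (c ∘ Fin.suc)

Subset : ℕ → Set₁
Subset n = V n → Set

module _ {n : ℕ} where

  _⊆_ : Subset n → Subset n → Set
  P ⊆ Q = ∀ x → P x → Q x

  _≐_ : Subset n → Subset n → Set
  P ≐ Q = (P ⊆ Q) × (Q ⊆ P)

  Full : Subset n
  Full _ = ⊤

  _∪_ : Subset n → Subset n → Subset n
  (P ∪ Q) x = P x ⊎ Q x

  _∩_ : Subset n → Subset n → Subset n
  (P ∩ Q) x = P x × Q x

  _⊕_ : Subset n → Subset n → Subset n
  (P ⊕ Q) x = ∃[ p ] ∃[ q ] (P p × Q q × x ≡ p +ᵥ q)

  Neg : Subset n → Subset n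
  Neg P x = ∃[ p ] (P p × x ≡ -ᵥ p)

  Diff : Subset n → Subset n
  Diff U x = ∃[ a ] ∃[ b ] (U a × U b × x ≡ a +ᵥ (-ᵥ b))

  Span : Subset n → Subset n
  Span U x = ∃[ m ] ∃[ c ] ∃[ u ] ((∀ i → U (u i)) × x ≡ lincomb m c u)

  Aff : Subset n → Subset n
  Aff U x = ∃[ m ] ∃[ c ] ∃[ u ] ((∀ i → U (u i)) × sum₃ m c ≡ f1 × x ≡ lincomb m c u)

  IsAffSub : Subset n → Set
  IsAffSub U = (∃[ u ] U u) ×
    (∀ x y (l : F3) → U x → U y → U ((l ·ᵥ x) +ᵥ ((f1 +₃ (-₃ l)) ·ᵥ y)))

  LinIndep : ∀ {k} → (Fin k → V n) → Set
  LinIndep {k} v = ∀ c → lincomb k c v ≡ 0ᵥ → ∀ i → c i ≡ f0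

  HasDim : Subset n → ℕ → Set
  HasDim S k = ∃[ v ] (LinIndep {k} v × (S ≐ λ x → ∃[ c ] x ≡ lincomb k c v))

  AffDim : Subset n → ℕ → Set
  AffDim U k = HasDim (Diff U) k

  IsHyperplane : Subset n → Subset n → Set
  IsHyperplane L H = IsAffSub H × H ⊆ L × ∃[ d ] (HasDim L (suc d) × AffDim H d)

  IsHalf : Subset n → Subset n → Subset n → Set
  IsHalf H U W =
    W ⊆ H ×
    ((W ⊕ Diff U) ≐ W) ×
    (H ≐ (U ∪ (W ∪ (Neg U ⊕ Neg W)))) ×
    (∀ x → U x → W x → ⊥) ×
    (∀ x → U x → (Neg U ⊕ Neg W) x → ⊥) ×
    (∀ x → W x → (Neg U ⊕ Neg W) x → ⊥)

-- Primitive subsets of an ambient linear space L ⊆ F₃ⁿ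
-- (L is F₃ⁿ itself at the top level, and C(U) in recursive calls)

data Primitive {n : ℕ} (L : Subset n) : Subset n → Set₁ where
  hyperplane : ∀ {A} → IsHyperplane L A → ¬ A 0ᵥ → Primitive L A
  glue : ∀ {A} (H U W X : Subset n) →
    IsHyperplane L H → ¬ H 0ᵥ →
    IsAffSub U → U ⊆ H → (∃[ h ] (H h × ¬ U h)) →
    IsHalf H U W →
    Primitive (Span U) X →
    (A ≐ (W ∪ X)) →
    (∀ x → X x → Diff U x → ⊥) →
    ((∃[ dH ] ∃[ dU ] (AffDim H dH × AffDim U dU × 2 + dU ≤ dH)) ⊎ ¬ (X ≐ Neg U)) →
    (Aff (X ∩ Neg U) ≐ Neg U) →
    Primitive L A

-- Over F₃, if points h₁, …, h₄ of an affine subspace H with 0 ∉ H satisfy ε₁h₁ + ⋯ + ε₄h₄ = 0 with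
-- signs εᵢ = ±1, then ε₁ + ⋯ + ε₄ = 0: a linear combination of points of H with coefficient sum 1
-- lies in H, and one with coefficient sum −1 lies in −H. For a hyperplane all signs are +1 and 4 ≠ 0.
-- In the glued case A = W ∪ X, the elements of W and of X ∩ U lie in H; since C(U) = [U] ∪ U ∪ −U
-- and X misses [U], the other elements of X lie in −U. So a zero sum has two summands p, q in
-- W ∪ (X ∩ U) and two summands −u₁, −u₂ in X ∩ −U. If p, q ∈ X, induction on X applies; if p ∈ W
-- and q ∈ U, then p = u₁ + u₂ − q ∈ U; if p, q ∈ W, then q = −m − p with m = −(u₁ + u₂) ∈ U.
-- Both contradict the definition of an (H,U)-half.

module Submission where

open import Defs
open import Algebra.Bundles using (CommutativeSemigroup)
open import Data.Empty using (⊥; ⊥-elim)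
open import Data.Fin using (zero; suc)
open import Data.Nat using (ℕ; zero; suc)
open import Data.Product using (_×_; _,_; proj₁; proj₂)
open import Data.Sum using (_⊎_; inj₁; inj₂; [_,_])
open import Data.Vec using ([]; _∷_; lookup)
open import Data.Vec.Properties
  using (zipWith-assoc; zipWith-comm; zipWith-identityˡ; zipWith-identityʳ;
         zipWith-inverseˡ; zipWith-inverseʳ; map-id; map-const; map-cong; map-∘; map-replicate)
open import Data.Vec.Relation.Unary.All using (All; []; _∷_)
open import Data.Vec.Relation.Unary.All.Properties using (lookup⁺)
import Data.Vec.Functional as Vector
open import Function using (_∘_; id)
open import Level using (0ℓ)
open import Relation.Binary.Definitions using (DecidableEquality)
open import Relation.Binary.PropositionalEquality
  using (_≡_; _≢_; refl; sym; trans; cong; cong₂; subst; module ≡-Reasoning)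
open import Relation.Binary.PropositionalEquality.Algebra using (isMagma)
open import Relation.Nullary using (¬_; Dec; yes; no)
open import Relation.Nullary.Decidable using (True; toWitness; map′; _×-dec_)

_≟₃_ : DecidableEquality F3
f0 ≟₃ f0 = yes refl
f0 ≟₃ f1 = no λ ()
f0 ≟₃ f2 = no λ ()
f1 ≟₃ f0 = no λ ()
f1 ≟₃ f1 = yes refl
f1 ≟₃ f2 = no λ ()
f2 ≟₃ f0 = no λ ()
f2 ≟₃ f1 = no λ ()
f2 ≟₃ f2 = yes refl

Op₃ : ℕ → Set
Op₃ zero    = F3
Op₃ (suc k) = F3 → Op₃ k

infix 4 _≗₃_ _≗₃?_

_≗₃_ : ∀ {k} → Op₃ k → Op₃ k → Set
_≗₃_ {zero}  x y = x ≡ y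
_≗₃_ {suc k} f g = ∀ x → f x ≗₃ g x

_≗₃?_ : ∀ {k} (f g : Op₃ k) → Dec (f ≗₃ g)
_≗₃?_ {zero}  x y = x ≟₃ y
_≗₃?_ {suc k} f g =
  map′ (λ (e₀ , e₁ , e₂) → λ { f0 → e₀ ; f1 → e₁ ; f2 → e₂ })
       (λ e → e f0 , e f1 , e f2)
       (f f0 ≗₃? g f0 ×-dec f f1 ≗₃? g f1 ×-dec f f2 ≗₃? g f2)

-- An identity in k variables over F₃ is proved by evaluating both sides at all 3ᵏ points.
by-exhaustion : ∀ k {f g : Op₃ k} {_ : True (f ≗₃? g)} → f ≗₃ g
by-exhaustion k {_} {_} {checked} = toWitness checked

module _ {n : ℕ} where

  +ᵥ-assoc : ∀ (x y z : V n) → (x +ᵥ y) +ᵥ z ≡ x +ᵥ (y +ᵥ z)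
  +ᵥ-assoc = zipWith-assoc (by-exhaustion 3)

  +ᵥ-comm : ∀ (x y : V n) → x +ᵥ y ≡ y +ᵥ x
  +ᵥ-comm = zipWith-comm (by-exhaustion 2)

  +ᵥ-identityˡ : ∀ (x : V n) → 0ᵥ +ᵥ x ≡ x
  +ᵥ-identityˡ = zipWith-identityˡ (by-exhaustion 1)

  +ᵥ-identityʳ : ∀ (x : V n) → x +ᵥ 0ᵥ ≡ x
  +ᵥ-identityʳ = zipWith-identityʳ (by-exhaustion 1)

  +ᵥ-inverseˡ : ∀ (x : V n) → (-ᵥ x) +ᵥ x ≡ 0ᵥ
  +ᵥ-inverseˡ = zipWith-inverseˡ (by-exhaustion 1)

  +ᵥ-inverseʳ : ∀ (x : V n) → x +ᵥ (-ᵥ x) ≡ 0ᵥ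
  +ᵥ-inverseʳ = zipWith-inverseʳ (by-exhaustion 1)

  -ᵥ-involutive : ∀ (x : V n) → -ᵥ (-ᵥ x) ≡ x
  -ᵥ-involutive x = trans (sym (map-∘ -₃_ -₃_ x)) (trans (map-cong (by-exhaustion 1) x) (map-id x))

  -ᵥ-zero : -ᵥ 0ᵥ ≡ 0ᵥ
  -ᵥ-zero = map-replicate -₃_ f0 n

  ·ᵥ-identity : ∀ (x : V n) → f1 ·ᵥ x ≡ x
  ·ᵥ-identity = map-id

  ·ᵥ-zero : ∀ (x : V n) → f0 ·ᵥ x ≡ 0ᵥ
  ·ᵥ-zero x = map-const x f0

  f2·ᵥ≡-ᵥ : ∀ (x : V n) → f2 ·ᵥ x ≡ -ᵥ x
  f2·ᵥ≡-ᵥ = map-cong (by-exhaustion 1)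

+ᵥ-commutativeSemigroup : ℕ → CommutativeSemigroup 0ℓ 0ℓ
+ᵥ-commutativeSemigroup n = record
  { Carrier                = V n
  ; _≈_                    = _≡_
  ; _∙_                    = _+ᵥ_
  ; isCommutativeSemigroup = record
    { isSemigroup = record { isMagma = isMagma _+ᵥ_ ; assoc = +ᵥ-assoc }
    ; comm        = +ᵥ-comm
    }
  }

f2*₃≡+₃ : ∀ x → f2 *₃ x ≡ x +₃ x
f2*₃≡+₃ = by-exhaustion 1

f2·ᵥ≡+ᵥ : ∀ {n} (x : V n) → f2 ·ᵥ x ≡ x +ᵥ x
f2·ᵥ≡+ᵥ []       = refl
f2·ᵥ≡+ᵥ (x ∷ xs) = cong₂ _∷_ (f2*₃≡+₃ x) (f2·ᵥ≡+ᵥ xs)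

-₃-distrib : ∀ x y → -₃ (x +₃ y) ≡ (-₃ x) +₃ (-₃ y)
-₃-distrib = by-exhaustion 2

-ᵥ-distrib : ∀ {n} (x y : V n) → -ᵥ (x +ᵥ y) ≡ (-ᵥ x) +ᵥ (-ᵥ y)
-ᵥ-distrib []       []       = refl
-ᵥ-distrib (x ∷ xs) (y ∷ ys) = cong₂ _∷_ (-₃-distrib x y) (-ᵥ-distrib xs ys)

*₃-midpoint : ∀ x y → (f2 *₃ x) +₃ (f2 *₃ y) ≡ -₃ (x +₃ y)
*₃-midpoint = by-exhaustion 2

·ᵥ-midpoint : ∀ {n} (x y : V n) → (f2 ·ᵥ x) +ᵥ (f2 ·ᵥ y) ≡ -ᵥ (x +ᵥ y)
·ᵥ-midpoint []       []       = refl
·ᵥ-midpoint (x ∷ xs) (y ∷ ys) = cong₂ _∷_ (*₃-midpoint x y) (·ᵥ-midpoint xs ys)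

+₃-cancel-pair : ∀ u v q p → ((u +₃ v) +₃ (-₃ q)) +₃ (p +₃ (q +₃ ((-₃ u) +₃ (-₃ v)))) ≡ p
+₃-cancel-pair = by-exhaustion 4

+ᵥ-cancel-pair : ∀ {n} (u v q p : V n) →
                 ((u +ᵥ v) +ᵥ (-ᵥ q)) +ᵥ (p +ᵥ (q +ᵥ ((-ᵥ u) +ᵥ (-ᵥ v)))) ≡ p
+ᵥ-cancel-pair []       []       []       []       = refl
+ᵥ-cancel-pair (u ∷ us) (v ∷ vs) (q ∷ qs) (p ∷ ps) =
  cong₂ _∷_ (+₃-cancel-pair u v q p) (+ᵥ-cancel-pair us vs qs ps)

sum≡0⇒p≡u₁+u₂-q : ∀ {n} {p q u₁ u₂ : V n} →
                  p +ᵥ (q +ᵥ ((-ᵥ u₁) +ᵥ (-ᵥ u₂))) ≡ 0ᵥ → p ≡ (u₁ +ᵥ u₂) +ᵥ (-ᵥ q)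
sum≡0⇒p≡u₁+u₂-q {p = p} {q} {u₁} {u₂} sum≡0 = begin
  p                     ≡⟨ sym (+ᵥ-cancel-pair u₁ u₂ q p) ⟩
  r +ᵥ (p +ᵥ (q +ᵥ _))  ≡⟨ cong (r +ᵥ_) sum≡0 ⟩
  r +ᵥ 0ᵥ               ≡⟨ +ᵥ-identityʳ r ⟩
  r                     ∎
  where open ≡-Reasoning
        r = (u₁ +ᵥ u₂) +ᵥ (-ᵥ q)

completion-step₃ : ∀ c s u l p →
  -₃ ((-₃ (((c *₃ u) +₃ ((f1 +₃ (-₃ c)) *₃ p)) +₃ (l +₃ ((f1 +₃ (-₃ s)) *₃ p)))) +₃ p)
    ≡ ((c *₃ u) +₃ l) +₃ ((f1 +₃ (-₃ (c +₃ s))) *₃ p)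
completion-step₃ = by-exhaustion 5

completion-step : ∀ {n} c s (u l p : V n) →
  -ᵥ ((-ᵥ (((c ·ᵥ u) +ᵥ ((f1 +₃ (-₃ c)) ·ᵥ p)) +ᵥ (l +ᵥ ((f1 +₃ (-₃ s)) ·ᵥ p)))) +ᵥ p)
    ≡ ((c ·ᵥ u) +ᵥ l) +ᵥ ((f1 +₃ (-₃ (c +₃ s))) ·ᵥ p)
completion-step c s []       []       []       = refl
completion-step c s (u ∷ us) (l ∷ ls) (p ∷ ps) =
  cong₂ _∷_ (completion-step₃ c s u l p) (completion-step c s us ls ps)

AffineClosed : ∀ {n} → Subset n → Set
AffineClosed H = ∀ x y (l : F3) → H x → H y → H ((l ·ᵥ x) +ᵥ ((f1 +₃ (-₃ l)) ·ᵥ y))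

module _ {n : ℕ} {H : Subset n} where

  -- Over F₃ the midpoint of x and y is 2x + 2y = −(x + y).
  midpoint-closed : AffineClosed H → ∀ {x y} → H x → H y → H (-ᵥ (x +ᵥ y))
  midpoint-closed closed {x} {y} Hx Hy = subst H (·ᵥ-midpoint x y) (closed x y f2 Hx Hy)

  parallelogram-closed : AffineClosed H → ∀ {x y z} → H x → H y → H z → H ((x +ᵥ y) +ᵥ (-ᵥ z))
  parallelogram-closed closed {x} {y} {z} Hx Hy Hz =
    subst H (trans (-ᵥ-distrib _ z) (cong (_+ᵥ (-ᵥ z)) (-ᵥ-involutive (x +ᵥ y))))
      (midpoint-closed closed (midpoint-closed closed Hx Hy) Hz)

  -- In the induction step c₀u₀ + L + (1 − c₀ − s)p = r + q − p, where r = c₀u₀ + (1 − c₀)p and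
  -- q = L + (1 − s)p lie in H.
  affine-completion : AffineClosed H → ∀ {p m c u s} → H p → (∀ i → H (u i)) → sum₃ m c ≡ s →
                      H (lincomb m c u +ᵥ ((f1 +₃ (-₃ s)) ·ᵥ p))
  affine-completion closed {p} {zero} Hp Hu refl =
    subst H (sym (trans (+ᵥ-identityˡ _) (·ᵥ-identity p))) Hp
  affine-completion closed {p} {suc m} {c} {u} Hp Hu refl =
    subst H (completion-step (c zero) (sum₃ m (c ∘ suc)) (u zero) (lincomb m (c ∘ suc) (u ∘ suc)) p)
      (midpoint-closed closed
        (midpoint-closed closed (closed _ _ (c zero) (Hu zero) Hp)
                                (affine-completion closed Hp (Hu ∘ suc) refl))
        Hp)

  Aff-⊆ : IsAffSub H → Aff H ⊆ H
  Aff-⊆ ((p , Hp) , closed) x (m , c , u , Hu , Σc≡1 , refl) =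
    subst H (trans (cong (x +ᵥ_) (·ᵥ-zero p)) (+ᵥ-identityʳ x)) (affine-completion closed Hp Hu Σc≡1)

  lincomb∈Diff : IsAffSub H → ∀ {m c u} → (∀ i → H (u i)) → sum₃ m c ≡ f0 → Diff H (lincomb m c u)
  lincomb∈Diff ((p , Hp) , closed) {m} {c} {u} Hu Σc≡0 =
    _ , p , affine-completion closed Hp Hu Σc≡0 , Hp , sym (begin
      (x +ᵥ (f1 ·ᵥ p)) +ᵥ (-ᵥ p) ≡⟨ cong (λ y → (x +ᵥ y) +ᵥ (-ᵥ p)) (·ᵥ-identity p) ⟩
      (x +ᵥ p) +ᵥ (-ᵥ p)         ≡⟨ +ᵥ-assoc x p (-ᵥ p) ⟩
      x +ᵥ (p +ᵥ (-ᵥ p))         ≡⟨ cong (x +ᵥ_) (+ᵥ-inverseʳ p) ⟩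
      x +ᵥ 0ᵥ                    ≡⟨ +ᵥ-identityʳ x ⟩
      x                          ∎)
    where open ≡-Reasoning
          x = lincomb m c u

  lincomb∈Neg : IsAffSub H → ∀ {m c u} → (∀ i → H (u i)) → sum₃ m c ≡ f2 → Neg H (lincomb m c u)
  lincomb∈Neg ((p , Hp) , closed) {m} {c} {u} Hu Σc≡2 =
    _ , midpoint-closed closed (affine-completion closed Hp Hu Σc≡2) Hp ,
    sym (trans (-ᵥ-involutive _) (begin
      (x +ᵥ (f2 ·ᵥ p)) +ᵥ p ≡⟨ +ᵥ-assoc x (f2 ·ᵥ p) p ⟩
      x +ᵥ ((f2 ·ᵥ p) +ᵥ p) ≡⟨ cong (λ y → x +ᵥ (y +ᵥ p)) (f2·ᵥ≡-ᵥ p) ⟩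
      x +ᵥ ((-ᵥ p) +ᵥ p)    ≡⟨ cong (x +ᵥ_) (+ᵥ-inverseˡ p) ⟩
      x +ᵥ 0ᵥ               ≡⟨ +ᵥ-identityʳ x ⟩
      x                     ∎))
    where open ≡-Reasoning
          x = lincomb m c u

  Span⊆Diff∪Self∪Neg : IsAffSub H → Span H ⊆ (Diff H ∪ (H ∪ Neg H))
  Span⊆Diff∪Self∪Neg affine _ (m , c , u , Hu , refl) with sum₃ m c in Σc
  ... | f0 = inj₁ (lincomb∈Diff affine Hu Σc)
  ... | f1 = inj₂ (inj₁ (Aff-⊆ affine _ (m , c , u , Hu , Σc , refl)))
  ... | f2 = inj₂ (inj₂ (lincomb∈Neg affine Hu Σc))

  lincomb≡0⇒sum₃≡0 : IsAffSub H → ¬ H 0ᵥ → ∀ {m c u} → (∀ i → H (u i)) →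
                     lincomb m c u ≡ 0ᵥ → sum₃ m c ≡ f0
  lincomb≡0⇒sum₃≡0 affine H∌0 {m} {c} {u} Hu x≡0 with sum₃ m c in Σc
  ... | f0 = refl
  ... | f1 = ⊥-elim (H∌0 (subst H x≡0 (Aff-⊆ affine _ (m , c , u , Hu , Σc , refl))))
  ... | f2 with lincomb∈Neg affine Hu Σc
  ...   | h , Hh , x≡-h = ⊥-elim (H∌0 (subst H h≡0 Hh))
    where
    open ≡-Reasoning
    h≡0 : h ≡ 0ᵥ
    h≡0 = begin
      h           ≡⟨ sym (-ᵥ-involutive h) ⟩
      -ᵥ (-ᵥ h)   ≡⟨ cong -ᵥ_ (trans (sym x≡-h) x≡0) ⟩
      -ᵥ 0ᵥ       ≡⟨ -ᵥ-zero ⟩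
      0ᵥ          ∎

  signed-sum₄ : IsAffSub H → ¬ H 0ᵥ → ∀ {a b c d s₁ s₂ s₃ s₄ h₁ h₂ h₃ h₄} →
                All H (h₁ ∷ h₂ ∷ h₃ ∷ h₄ ∷ []) →
                a ≡ s₁ ·ᵥ h₁ → b ≡ s₂ ·ᵥ h₂ → c ≡ s₃ ·ᵥ h₃ → d ≡ s₄ ·ᵥ h₄ →
                a +ᵥ (b +ᵥ (c +ᵥ d)) ≡ 0ᵥ → s₁ +₃ (s₂ +₃ (s₃ +₃ (s₄ +₃ f0))) ≡ f0
  signed-sum₄ affine H∌0 {s₁ = s₁} {s₂} {s₃} {s₄} {h₁} {h₂} {h₃} {h₄} Hh refl refl refl refl sum≡0 =
    lincomb≡0⇒sum₃≡0 affine H∌0 {4} {lookup (s₁ ∷ s₂ ∷ s₃ ∷ s₄ ∷ [])} {lookup (h₁ ∷ h₂ ∷ h₃ ∷ h₄ ∷ [])}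
      (lookup⁺ Hh) (trans (cong (λ x → _ +ᵥ (_ +ᵥ (_ +ᵥ x))) (+ᵥ-identityʳ _)) sum≡0)

-- Over F₃ closure under addition already gives closure under scalars, since 2x = x + x.
AdditivelyClosed : ∀ {n} → Subset n → Set
AdditivelyClosed T = T 0ᵥ × (∀ {x y} → T x → T y → T (x +ᵥ y))

module _ {n : ℕ} {T : Subset n} (closed : AdditivelyClosed T) where

  ·ᵥ-closed : ∀ c {x} → T x → T (c ·ᵥ x)
  ·ᵥ-closed f0 {x} _  = subst T (sym (·ᵥ-zero x)) (proj₁ closed)
  ·ᵥ-closed f1 {x} Tx = subst T (sym (·ᵥ-identity x)) Tx
  ·ᵥ-closed f2 {x} Tx = subst T (sym (f2·ᵥ≡+ᵥ x)) (proj₂ closed Tx Tx)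

  lincomb-closed : ∀ {m c u} → (∀ i → T (u i)) → T (lincomb m c u)
  lincomb-closed {zero}  _  = proj₁ closed
  lincomb-closed {suc m} {c} Tu =
    proj₂ closed (·ᵥ-closed (c zero) (Tu zero)) (lincomb-closed (Tu ∘ suc))

Span-minimal : ∀ {n} {U T : Subset n} → U ⊆ T → AdditivelyClosed T → Span U ⊆ T
Span-minimal U⊆T closed _ (_ , _ , _ , Uu , refl) = lincomb-closed closed (λ i → U⊆T _ (Uu i))

Span-closed : ∀ {n} {U : Subset n} → AdditivelyClosed (Span U)
Span-closed {U = U} =
  (zero , (λ ()) , (λ ()) , (λ ()) , refl) , λ { (m , c , u , Uu , refl) → lincomb+Span m c u Uu }
  where
  lincomb+Span : ∀ m c u → (∀ i → U (u i)) → ∀ {y} → Span U y → Span U (lincomb m c u +ᵥ y)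
  lincomb+Span zero    _ _ _  Sy = subst (Span U) (sym (+ᵥ-identityˡ _)) Sy
  lincomb+Span (suc m) c u Uu Sy with lincomb+Span m (c ∘ suc) (u ∘ suc) (Uu ∘ suc) Sy
  ... | k , d , w , Uw , eq =
    suc k , c zero Vector.∷ d , u zero Vector.∷ w , (λ { zero → Uu zero ; (suc i) → Uw i }) ,
    trans (+ᵥ-assoc _ _ _) (cong ((c zero ·ᵥ u zero) +ᵥ_) eq)

Primitive⇒⊆ : ∀ {n} {L A : Subset n} → Primitive L A → AdditivelyClosed L → A ⊆ L
Primitive⇒⊆ (hyperplane (_ , A⊆L , _) _) _ = A⊆L
Primitive⇒⊆ (glue H U W X (_ , H⊆L , _) _ _ U⊆H _ (W⊆H , _) X-primitive (A⊆W∪X , _) _ _ _) L-closed x Ax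
  with A⊆W∪X x Ax
... | inj₁ Wx = H⊆L x (W⊆H x Wx)
... | inj₂ Xx =
  Span-minimal (λ y Uy → H⊆L y (U⊆H y Uy)) L-closed x (Primitive⇒⊆ X-primitive (Span-closed {U = U}) x Xx)

ZeroSumFree₄ : ∀ {n} → Subset n → Set
ZeroSumFree₄ A = ∀ {a b c d} → A a → A b → A c → A d → a +ᵥ (b +ᵥ (c +ᵥ d)) ≢ 0ᵥ

module Glue {n} {H U W X : Subset n}
  (H-affine : IsAffSub H) (H∌0 : ¬ H 0ᵥ) (U-affine : IsAffSub U) (U⊆H : U ⊆ H) (W⊆H : W ⊆ H)
  (U∩W=∅ : ∀ x → U x → W x → ⊥) (W∩-U-W=∅ : ∀ x → W x → (Neg U ⊕ Neg W) x → ⊥)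
  (X⊆U∪-U : X ⊆ (U ∪ Neg U)) (X-zero-sum-free : ZeroSumFree₄ X) where

  open import Algebra.Properties.CommutativeSemigroup (+ᵥ-commutativeSemigroup n)
    using (x∙yz≈y∙xz; x∙yz≈y∙zx; x∙yz≈z∙xy)

  Positive : Subset n
  Positive x = W x ⊎ (X x × U x)

  data Part : V n → Set where
    pos : ∀ {x} → Positive x → Part x
    neg : ∀ {u} → U u → X (-ᵥ u) → Part (-ᵥ u)

  part : ∀ {x} → (W ∪ X) x → Part x
  part (inj₁ Wx) = pos (inj₁ Wx)
  part (inj₂ Xx) with X⊆U∪-U _ Xx
  ... | inj₁ Ux              = pos (inj₂ (Xx , Ux))
  ... | inj₂ (_ , Uu , refl) = neg Uu Xx

  sign : ∀ {x} → Part x → F3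
  sign (pos _)   = f1
  sign (neg _ _) = f2

  point : ∀ {x} → Part x → V n
  point {x} (pos _)   = x
  point (neg {u} _ _) = u

  point∈H : ∀ {x} (π : Part x) → H (point π)
  point∈H (pos (inj₁ Wx))       = W⊆H _ Wx
  point∈H (pos (inj₂ (_ , Ux))) = U⊆H _ Ux
  point∈H (neg Uu _)            = U⊆H _ Uu

  part≡sign·point : ∀ {x} (π : Part x) → x ≡ sign π ·ᵥ point π
  part≡sign·point (pos _)   = sym (·ᵥ-identity _)
  part≡sign·point (neg _ _) = sym (f2·ᵥ≡-ᵥ _)

  W-U-case : ∀ {p q u₁ u₂ : V n} → W p → U q → U u₁ → U u₂ →
             p +ᵥ (q +ᵥ ((-ᵥ u₁) +ᵥ (-ᵥ u₂))) ≢ 0ᵥ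
  W-U-case Wp Uq Uu₁ Uu₂ sum≡0 =
    U∩W=∅ _ (subst U (sym (sum≡0⇒p≡u₁+u₂-q sum≡0)) (parallelogram-closed (proj₂ U-affine) Uu₁ Uu₂ Uq))
      Wp

  W-W-case : ∀ {p q u₁ u₂ : V n} → W p → W q → U u₁ → U u₂ →
             p +ᵥ (q +ᵥ ((-ᵥ u₁) +ᵥ (-ᵥ u₂))) ≢ 0ᵥ
  W-W-case {p} {q} Wp Wq Uu₁ Uu₂ sum≡0 =
    W∩-U-W=∅ _ Wq (_ , _ , (_ , midpoint-closed (proj₂ U-affine) Uu₁ Uu₂ , refl) , (p , Wp , refl) ,
      trans (sum≡0⇒p≡u₁+u₂-q (trans (x∙yz≈y∙xz q p _) sum≡0))
            (cong (_+ᵥ (-ᵥ p)) (sym (-ᵥ-involutive _))))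

  two-pos-two-neg : ∀ {p q u₁ u₂ : V n} → Positive p → Positive q →
                    U u₁ → U u₂ → X (-ᵥ u₁) → X (-ᵥ u₂) →
                    p +ᵥ (q +ᵥ ((-ᵥ u₁) +ᵥ (-ᵥ u₂))) ≢ 0ᵥ
  two-pos-two-neg (inj₂ (Xp , _)) (inj₂ (Xq , _)) _ _ Xn₁ Xn₂ = X-zero-sum-free Xp Xq Xn₁ Xn₂
  two-pos-two-neg (inj₁ Wp) (inj₂ (_ , Uq)) Uu₁ Uu₂ _ _ = W-U-case Wp Uq Uu₁ Uu₂
  two-pos-two-neg {p} {q} (inj₂ (_ , Up)) (inj₁ Wq) Uu₁ Uu₂ _ _ sum≡0 =
    W-U-case Wq Up Uu₁ Uu₂ (trans (x∙yz≈y∙xz q p _) sum≡0)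
  two-pos-two-neg (inj₁ Wp) (inj₁ Wq) Uu₁ Uu₂ _ _ = W-W-case Wp Wq Uu₁ Uu₂

  -- Four signs ±1 cancel exactly when two of them are −1; the other ten patterns are absurd.
  balanced : ∀ {a b c d} (πa : Part a) (πb : Part b) (πc : Part c) (πd : Part d) →
             sign πa +₃ (sign πb +₃ (sign πc +₃ (sign πd +₃ f0))) ≡ f0 →
             a +ᵥ (b +ᵥ (c +ᵥ d)) ≢ 0ᵥ
  balanced (pos Pa) (pos Pb) (neg U₁ X₁) (neg U₂ X₂) _ = two-pos-two-neg Pa Pb U₁ U₂ X₁ X₂
  balanced {a} {b} {c} {d} (pos Pa) (neg U₁ X₁) (pos Pc) (neg U₂ X₂) _ sum≡0 =
    two-pos-two-neg Pa Pc U₁ U₂ X₁ X₂ (trans (cong (a +ᵥ_) (x∙yz≈y∙xz c b d)) sum≡0)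
  balanced {a} {b} {c} {d} (pos Pa) (neg U₁ X₁) (neg U₂ X₂) (pos Pd) _ sum≡0 =
    two-pos-two-neg Pa Pd U₁ U₂ X₁ X₂ (trans (cong (a +ᵥ_) (x∙yz≈y∙zx d b c)) sum≡0)
  balanced {a} {b} {c} {d} (neg U₁ X₁) (pos Pb) (pos Pc) (neg U₂ X₂) _ sum≡0 =
    two-pos-two-neg Pb Pc U₁ U₂ X₁ X₂
      (trans (cong (b +ᵥ_) (x∙yz≈y∙xz c a d)) (trans (x∙yz≈y∙xz b a _) sum≡0))
  balanced {a} {b} {c} {d} (neg U₁ X₁) (pos Pb) (neg U₂ X₂) (pos Pd) _ sum≡0 =
    two-pos-two-neg Pb Pd U₁ U₂ X₁ X₂
      (trans (cong (b +ᵥ_) (x∙yz≈y∙zx d a c)) (trans (x∙yz≈y∙xz b a _) sum≡0))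
  balanced {a} {b} {c} {d} (neg U₁ X₁) (neg U₂ X₂) (pos Pc) (pos Pd) _ sum≡0 =
    two-pos-two-neg Pc Pd U₁ U₂ X₁ X₂
      (trans (x∙yz≈z∙xy c d _) (trans (+ᵥ-assoc a b _) sum≡0))
  balanced (pos _)   (pos _)   (pos _)   (pos _)   ()
  balanced (pos _)   (pos _)   (pos _)   (neg _ _) ()
  balanced (pos _)   (pos _)   (neg _ _) (pos _)   ()
  balanced (pos _)   (neg _ _) (pos _)   (pos _)   ()
  balanced (pos _)   (neg _ _) (neg _ _) (neg _ _) ()
  balanced (neg _ _) (pos _)   (pos _)   (pos _)   ()
  balanced (neg _ _) (pos _)   (neg _ _) (neg _ _) ()
  balanced (neg _ _) (neg _ _) (pos _)   (neg _ _) ()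
  balanced (neg _ _) (neg _ _) (neg _ _) (pos _)   ()
  balanced (neg _ _) (neg _ _) (neg _ _) (neg _ _) ()

  zero-sum-free : ZeroSumFree₄ (W ∪ X)
  zero-sum-free Aa Ab Ac Ad sum≡0 = balanced πa πb πc πd
    (signed-sum₄ H-affine H∌0 (point∈H πa ∷ point∈H πb ∷ point∈H πc ∷ point∈H πd ∷ [])
       (part≡sign·point πa) (part≡sign·point πb) (part≡sign·point πc) (part≡sign·point πd) sum≡0)
    sum≡0
    where πa = part Aa
          πb = part Ab
          πc = part Ac
          πd = part Ad

Primitive⇒ZeroSumFree₄ : ∀ {n} {L A : Subset n} → Primitive L A → ZeroSumFree₄ A
Primitive⇒ZeroSumFree₄ (hyperplane (A-affine , _) A∌0) Aa Ab Ac Ad sum≡0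
  with signed-sum₄ A-affine A∌0 (Aa ∷ Ab ∷ Ac ∷ Ad ∷ [])
         (sym (·ᵥ-identity _)) (sym (·ᵥ-identity _)) (sym (·ᵥ-identity _)) (sym (·ᵥ-identity _)) sum≡0
... | ()
Primitive⇒ZeroSumFree₄
  (glue H U W X (H-affine , _) H∌0 U-affine U⊆H _ (W⊆H , _ , _ , U∩W=∅ , _ , W∩-U-W=∅)
        X-primitive (A⊆W∪X , _) X∩[U]=∅ _ _) Aa Ab Ac Ad =
  Glue.zero-sum-free H-affine H∌0 U-affine U⊆H W⊆H U∩W=∅ W∩-U-W=∅ X⊆U∪-U
    (Primitive⇒ZeroSumFree₄ X-primitive) (A⊆W∪X _ Aa) (A⊆W∪X _ Ab) (A⊆W∪X _ Ac) (A⊆W∪X _ Ad)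
  where
  X⊆U∪-U : X ⊆ (U ∪ Neg U)
  X⊆U∪-U x Xx = [ (λ [U]x → ⊥-elim (X∩[U]=∅ x Xx [U]x)) , id ]
    (Span⊆Diff∪Self∪Neg U-affine x (Primitive⇒⊆ X-primitive (Span-closed {U = U}) x Xx))

lemma2p3 : (n : ℕ) (A : Subset n) → Primitive Full A → ¬ ((A ⊕ (A ⊕ (A ⊕ A))) 0ᵥ)
lemma2p3 n A A-primitive (a , _ , Aa , (b , _ , Ab , (c , d , Ac , Ad , refl) , refl) , 0≡sum) =
  Primitive⇒ZeroSumFree₄ A-primitive Aa Ab Ac Ad (sym 0≡sum)
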